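{- Let $S\subset\mathbb{R}^2$ be a rational median set. Then there exists a square-free integer $k$ such that whenever $T$ is a similarity transformation of $\mathbb{R}^2$ mapping two points of $S$ to $(0,0)$ and $(1,0)$, every point of $T(S)$ has the form $(r_1, r_2\sqrt{k})$ with $r_1,r_2\in\mathbb{Q}$.
   Context: A rational median set is a set $S$ of points in $\mathbb{R}^2$, not all collinear, such that for every three non-collinear points $p_1,p_2,p_3\in S$, all three medians of the triangle with vertices $p_1,p_2,p_3$ have rational length. A median of a triangle is the segment joining a vertex to the midpoint of the opposite side. A similarity transformation is a composition of an isometry of $\mathbb{R}^2$ with a scaling by a positive factor. -}

module Defs where

open import Data.Nat as ℕ using (ℕ; zero; suc)
open import Data.Integer as ℤ using (ℤ; +_; -[1+_])
open import Data.Integer.Divisibility as ℤD using ()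
open import Data.Nat.Divisibility as ℕD using ()
open import Data.Rational as ℚ using (ℚ)
open import Data.Product using (Σ; ∃; ∃-syntax; _×_; _,_; proj₁; proj₂)
open import Data.Sum using (_⊎_)
open import Relation.Binary.PropositionalEquality using (_≡_; _≢_)
open import Relation.Binary.Structures using (IsStrictTotalOrder)
open import Algebra.Structures using (IsCommutativeRing)
open import Relation.Nullary using (¬_)

-- Square-free integer: no square d² with d ≠ 1 divides k (this excludes k = 0).
SquareFree : ℤ → Set
SquareFree k = ∀ (d : ℕ) → (d ℕ.* d) ℕD.∣ ℤ.∣ k ∣ → d ≡ 1

-- A complete ordered field (any model is isomorphic to ℝ).
record RealField : Set₁ where
  infixl 6 _+_ _-_
  infixl 7 _*_
  infix 4 _<_ _≤_
  field
    R    : Set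
    0r 1r : R
    _+_ _*_ : R → R → R
    -_   : R → R
    _<_  : R → R → Set
    isCommutativeRing : IsCommutativeRing _≡_ _+_ _*_ -_ 0r 1r
    0≢1  : 0r ≢ 1r
    inverse : ∀ x → x ≢ 0r → ∃[ y ] (x * y ≡ 1r)
    isStrictTotalOrder : IsStrictTotalOrder _≡_ _<_
    +-mono-< : ∀ {x y} z → x < y → x + z < y + z
    *-pos    : ∀ {x y} → 0r < x → 0r < y → 0r < x * y
  _-_ : R → R → R
  x - y = x + (- y)
  _≤_ : R → R → Set
  x ≤ y = x < y ⊎ x ≡ y
  field
    complete : ∀ (P : R → Set) → (∃[ x ] P x) → (∃[ u ] (∀ x → P x → x ≤ u)) →
               ∃[ s ] ((∀ x → P x → x ≤ s) × (∀ u → (∀ x → P x → x ≤ u) → s ≤ u))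

  fromℕ : ℕ → R
  fromℕ zero = 0r
  fromℕ (suc n) = 1r + fromℕ n

  fromℤ : ℤ → R
  fromℤ (+ n) = fromℕ n
  fromℤ -[1+ n ] = - fromℕ (suc n)

  _≈ℚ_ : R → ℚ → Set
  x ≈ℚ q = x * fromℕ (ℚ.ℚ.denominatorℕ q) ≡ fromℤ (ℚ.ℚ.numerator q)

  IsRational : R → Set
  IsRational x = ∃[ q ] (x ≈ℚ q)

  Point : Set
  Point = R × R

  origin : Point
  origin = 0r , 0r

  e₁ : Point
  e₁ = 1r , 0r

  sqDist : Point → Point → R
  sqDist (x₁ , y₁) (x₂ , y₂) = (x₁ - x₂) * (x₁ - x₂) + (y₁ - y₂) * (y₁ - y₂)

  IsDist : Point → Point → R → Set
  IsDist p q r = 0r ≤ r × r * r ≡ sqDist p q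

  RationalLength : Point → Point → Set
  RationalLength p q = ∃[ r ] (IsDist p q r × IsRational r)

  _⊕_ : Point → Point → Point
  (x₁ , y₁) ⊕ (x₂ , y₂) = (x₁ + x₂) , (y₁ + y₂)

  _·_ : R → Point → Point
  c · (x , y) = (c * x) , (c * y)

  -- m is the midpoint of the segment qr (m + m = q + r; unique in characteristic 0)
  IsMidpoint : Point → Point → Point → Set
  IsMidpoint q r m = m ⊕ m ≡ q ⊕ r

  RationalMedian : Point → Point → Point → Set
  RationalMedian p q r = ∀ m → IsMidpoint q r m → RationalLength p m

  Collinear : Point → Point → Point → Set
  Collinear (x₁ , y₁) (x₂ , y₂) (x₃ , y₃) =
    (x₂ - x₁) * (y₃ - y₁) ≡ (y₂ - y₁) * (x₃ - x₁)

  RationalMedianSet : (Point → Set) → Set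
  RationalMedianSet S =
    (∃[ p₁ ] ∃[ p₂ ] ∃[ p₃ ] (S p₁ × S p₂ × S p₃ × ¬ Collinear p₁ p₂ p₃)) ×
    (∀ p₁ p₂ p₃ → S p₁ → S p₂ → S p₃ → ¬ Collinear p₁ p₂ p₃ →
       RationalMedian p₁ p₂ p₃ × RationalMedian p₂ p₃ p₁ × RationalMedian p₃ p₁ p₂)

  -- isometry of the plane: a distance-preserving map
  -- (preserving squared distance is the same as preserving distance)
  IsIsometry : (Point → Point) → Set
  IsIsometry f = ∀ p q → sqDist (f p) (f q) ≡ sqDist p q

  IsSimilarity : (Point → Point) → Set
  IsSimilarity T = ∃[ f ] ∃[ c ] (IsIsometry f × 0r < c × (∀ p → T p ≡ c · f p))

  -- the point has the form (r₁ , r₂ √k) with r₁, r₂ rational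
  -- (s plays the role of √k: s ≥ 0 and s² = k)
  HasForm : ℤ → Point → Set
  HasForm k (x , y) = ∃[ r₂ ] ∃[ s ]
    (IsRational x × IsRational r₂ × 0r ≤ s × s * s ≡ fromℤ k × y ≡ r₂ * s)

-- Medians determine sides (9|uv|² = 2·4m_u² + 2·4m_v² - 4m_w²), so all squared
-- distances within S are rational, hence by polarisation all dot products of
-- difference vectors. By Binet–Cauchy a product of two cross products is a 2×2
-- determinant of dot products, so cross(a,b,p)·Δ is rational, where Δ is the cross
-- product of a fixed non-collinear triple of S; thus Δ² is rational and Δ ∈ ℚ·√K for
-- a square-free K. A similarity T with Ta = (0,0), Tb = (1,0) scales squared
-- distances by c² with c²·|ab|² = 1; the x-coordinate of Tp is a dot product with
-- (1,0), hence rational, and the y-coordinate is cross(Ta,Tb,Tp) = ±c²·cross(a,b,p),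
-- which lies in ℚ/Δ = ℚ·√K.

module Submission where

open import Defs
open import Data.Integer using (ℤ)
open import Data.Product using (Σ; ∃; ∃-syntax; _×_; _,_)
open import Relation.Binary.PropositionalEquality using (_≡_)

module SquareFreeDecomposition where
  open import Data.Nat
  open import Data.Nat.Properties
  open import Data.Nat.Divisibility
  open import Data.Nat.Induction using (<-rec)
  open import Data.Nat.Tactic.RingSolver using (solve-∀)
  open import Data.Empty using (⊥-elim)
  open import Relation.Nullary using (yes; no)
  open import Relation.Nullary.Decidable using (_×-dec_)
  open import Relation.Binary.PropositionalEquality

  record SquareFreeSplitting (N : ℕ) : Set where
    field
      core cofactor : ℕ
      splits        : N ≡ core * (cofactor * cofactor)
      cofactor≥1    : 1 ≤ cofactor
      core-sqfree   : ∀ d → d * d ∣ core → d ≡ 1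

  -- Every N ≥ 1 splits. By strong induction: if some d ≥ 2 has d² ∣ N, split
  -- N / d² < N and absorb d into the cofactor; otherwise N itself is square-free.
  splitting : ∀ N → 1 ≤ N → SquareFreeSplitting N
  splitting = <-rec (λ N → 1 ≤ N → SquareFreeSplitting N) step
    where
    regroup : ∀ K M d → K * (M * M) * (d * d) ≡ K * ((M * d) * (M * d))
    regroup = solve-∀

    step : ∀ N → (∀ {q} → q < N → 1 ≤ q → SquareFreeSplitting q) → 1 ≤ N → SquareFreeSplitting N
    step N split< 1≤N with anyUpTo? (λ d → (2 ≤? d) ×-dec (d * d ∣? N)) (suc N)
    ... | yes (d , _ , 2≤d , divides q N≡q*dd) = record
      { core = core ; cofactor = cofactor * d
      ; splits = trans N≡q*dd (trans (cong (_* (d * d)) splits) (regroup core cofactor d))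
      ; cofactor≥1 = *-mono-≤ cofactor≥1 (≤-trans (s≤s z≤n) 2≤d)
      ; core-sqfree = core-sqfree }
      where
      1≤q : 1 ≤ q
      1≤q = n≢0⇒n>0 λ { refl → <⇒≢ 1≤N (sym N≡q*dd) }
      1<d*d : 1 < d * d
      1<d*d = <-≤-trans 2≤d (m≤m*n d d {{>-nonZero (<-≤-trans (s≤s z≤n) 2≤d)}})
      q<N : q < N
      q<N = subst (q <_) (sym N≡q*dd)
              (subst (_< q * (d * d)) (*-identityʳ q) (*-monoʳ-< q {{>-nonZero 1≤q}} 1<d*d))
      open SquareFreeSplitting (split< q<N 1≤q)
    ... | no noSquare = record
      { core = N ; cofactor = 1 ; splits = sym (*-identityʳ N)
      ; cofactor≥1 = ≤-refl ; core-sqfree = sqfree }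
      where
      sqfree : ∀ d → d * d ∣ N → d ≡ 1
      sqfree zero 0∣N = ⊥-elim (<⇒≢ 1≤N (sym (0∣⇒≡0 0∣N)))
      sqfree (suc zero) _ = refl
      sqfree (suc (suc d)) dd∣N = ⊥-elim (noSquare (D , D<1+N , s≤s (s≤s z≤n) , dd∣N))
        where
        D = suc (suc d)
        D<1+N : D < suc N
        D<1+N = s≤s (≤-trans (m≤m*n D D) (∣⇒≤ {{>-nonZero 1≤N}} dd∣N))

module RealArithmetic (ℝ : RealField) where
  open RealField ℝ
  open import Algebra.Bundles using (CommutativeRing)
  open import Algebra.Solver.Ring.AlmostCommutativeRing
    using (_-Raw-AlmostCommutative⟶_; fromCommutativeRing)
  open import Data.Nat as ℕ using (ℕ; zero; suc)
  open import Data.Integer as ℤ using (-[1+_]) renaming (+_ to pos)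
  import Data.Integer.Properties as ℤP
  open import Data.Sign as Sign using (Sign)
  open import Data.Maybe using (Maybe; just; nothing)
  open import Data.Empty using (⊥-elim)
  open import Data.Sum using (_⊎_; inj₁; inj₂)
  open import Relation.Nullary using (yes; no)
  open import Relation.Binary.Definitions using (tri<; tri≈; tri>)
  open import Relation.Binary.Structures using (IsStrictTotalOrder)
  open import Relation.Binary.PropositionalEquality
  open ≡-Reasoning

  commutativeRing : CommutativeRing _ _
  commutativeRing = record { isCommutativeRing = isCommutativeRing }

  open CommutativeRing commutativeRing public
    using ( +-assoc; +-comm; +-identityˡ; +-identityʳ; -‿inverseʳ
          ; *-assoc; *-comm; *-identityˡ; *-identityʳ; zeroʳ )
  open CommutativeRing commutativeRing
    using (semiring; ring; +-group; +-abelianGroup; *-commutativeSemigroup)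
  open import Algebra.Properties.Ring ring using (-‿distribˡ-*)
  open import Algebra.Properties.AbelianGroup +-abelianGroup using (⁻¹-∙-comm)
  open import Algebra.Properties.Group +-group using (⁻¹-involutive; ε⁻¹≈ε)
  open import Algebra.Properties.CommutativeSemigroup *-commutativeSemigroup
    using () renaming (interchange to *-interchange)
  import Algebra.Properties.Semiring.Mult semiring as Mult
  open IsStrictTotalOrder isStrictTotalOrder public
    using (compare; irrefl; asym) renaming (trans to <-trans; _≟_ to _≟R_)

  -- fromℕ n is the n-fold sum of 1r, so it is a semiring homomorphism.
  fromℕ≡×1 : ∀ n → fromℕ n ≡ n Mult.× 1r
  fromℕ≡×1 zero = refl
  fromℕ≡×1 (suc n) = cong (1r +_) (fromℕ≡×1 n)

  fromℕ-+ : ∀ m n → fromℕ (m ℕ.+ n) ≡ fromℕ m + fromℕ n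
  fromℕ-+ m n = begin
    fromℕ (m ℕ.+ n)            ≡⟨ fromℕ≡×1 (m ℕ.+ n) ⟩
    (m ℕ.+ n) Mult.× 1r        ≡⟨ Mult.×-homo-+ 1r m n ⟩
    m Mult.× 1r + n Mult.× 1r  ≡⟨ sym (cong₂ _+_ (fromℕ≡×1 m) (fromℕ≡×1 n)) ⟩
    fromℕ m + fromℕ n          ∎

  fromℕ-* : ∀ m n → fromℕ (m ℕ.* n) ≡ fromℕ m * fromℕ n
  fromℕ-* m n = begin
    fromℕ (m ℕ.* n)              ≡⟨ fromℕ≡×1 (m ℕ.* n) ⟩
    (m ℕ.* n) Mult.× 1r          ≡⟨ Mult.×1-homo-* m n ⟩
    m Mult.× 1r * n Mult.× 1r    ≡⟨ sym (cong₂ _*_ (fromℕ≡×1 m) (fromℕ≡×1 n)) ⟩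
    fromℕ m * fromℕ n            ∎

  fromℤ-⊖ : ∀ m n → fromℤ (m ℤ.⊖ n) ≡ fromℕ m - fromℕ n
  fromℤ-⊖ zero zero = sym (trans (cong (0r +_) ε⁻¹≈ε) (+-identityʳ 0r))
  fromℤ-⊖ zero (suc n) = sym (+-identityˡ _)
  fromℤ-⊖ (suc m) zero = sym (trans (cong (fromℕ (suc m) +_) ε⁻¹≈ε) (+-identityʳ _))
  fromℤ-⊖ (suc m) (suc n) = begin
    fromℤ (suc m ℤ.⊖ suc n)              ≡⟨ cong fromℤ (ℤP.[1+m]⊖[1+n]≡m⊖n m n) ⟩
    fromℤ (m ℤ.⊖ n)                      ≡⟨ fromℤ-⊖ m n ⟩
    fromℕ m + - fromℕ n                  ≡⟨ sym (+-identityˡ _) ⟩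
    0r + (fromℕ m + - fromℕ n)           ≡⟨ cong (_+ (fromℕ m + - fromℕ n)) (sym (-‿inverseʳ 1r)) ⟩
    (1r + - 1r) + (fromℕ m + - fromℕ n)  ≡⟨ +-assoc 1r _ _ ⟩
    1r + (- 1r + (fromℕ m + - fromℕ n))  ≡⟨ cong (1r +_) (trans (sym (+-assoc _ _ _))
                                             (trans (cong (_+ - fromℕ n) (+-comm _ _)) (+-assoc _ _ _))) ⟩
    1r + (fromℕ m + (- 1r + - fromℕ n))  ≡⟨ sym (+-assoc 1r _ _) ⟩
    (1r + fromℕ m) + (- 1r + - fromℕ n)  ≡⟨ cong ((1r + fromℕ m) +_) (⁻¹-∙-comm 1r (fromℕ n)) ⟩
    (1r + fromℕ m) + - (1r + fromℕ n)    ∎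

  fromℤ-+ : ∀ i j → fromℤ (i ℤ.+ j) ≡ fromℤ i + fromℤ j
  fromℤ-+ (pos m) (pos n) = fromℕ-+ m n
  fromℤ-+ (pos m) -[1+ n ] = fromℤ-⊖ m (suc n)
  fromℤ-+ -[1+ m ] (pos n) = trans (fromℤ-⊖ n (suc m)) (+-comm _ _)
  fromℤ-+ -[1+ m ] -[1+ n ] = begin
    - fromℕ (suc (suc (m ℕ.+ n)))                 ≡⟨ cong (λ t → - (1r + t)) (fromℕ-+ (suc m) n) ⟩
    - (1r + ((1r + fromℕ m) + fromℕ n))           ≡⟨ cong -_ (trans (sym (+-assoc _ _ _))
                                                      (trans (cong (_+ fromℕ n) (+-comm 1r _)) (+-assoc _ _ _))) ⟩
    - ((1r + fromℕ m) + (1r + fromℕ n))           ≡⟨ sym (⁻¹-∙-comm _ _) ⟩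
    - (1r + fromℕ m) + - (1r + fromℕ n)           ∎

  fromℤ-neg : ∀ i → fromℤ (ℤ.- i) ≡ - fromℤ i
  fromℤ-neg (pos zero) = sym ε⁻¹≈ε
  fromℤ-neg (pos (suc n)) = refl
  fromℤ-neg -[1+ n ] = sym (⁻¹-involutive _)

  signum : Sign → R
  signum Sign.+ = 1r
  signum Sign.- = - 1r

  signum-* : ∀ s t → signum (s Sign.* t) ≡ signum s * signum t
  signum-* Sign.+ t = sym (*-identityˡ _)
  signum-* Sign.- Sign.+ = sym (*-identityʳ _)
  signum-* Sign.- Sign.- =
    sym (trans (sym (-‿distribˡ-* _ _)) (trans (cong -_ (*-identityˡ _)) (⁻¹-involutive _)))

  fromℤ-◃ : ∀ s n → fromℤ (s ℤ.◃ n) ≡ signum s * fromℕ n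
  fromℤ-◃ Sign.- zero = sym (zeroʳ _)
  fromℤ-◃ Sign.+ zero = sym (zeroʳ _)
  fromℤ-◃ Sign.- (suc n) = trans (cong -_ (sym (*-identityˡ _))) (-‿distribˡ-* _ _)
  fromℤ-◃ Sign.+ (suc n) = sym (*-identityˡ _)

  fromℤ-* : ∀ i j → fromℤ (i ℤ.* j) ≡ fromℤ i * fromℤ j
  fromℤ-* i j = begin
    fromℤ (i ℤ.* j)                  ≡⟨ fromℤ-◃ (ℤ.sign i Sign.* ℤ.sign j) (ℤ.∣ i ∣ ℕ.* ℤ.∣ j ∣) ⟩
    signum (ℤ.sign i Sign.* ℤ.sign j) * fromℕ (ℤ.∣ i ∣ ℕ.* ℤ.∣ j ∣)
                                     ≡⟨ cong₂ _*_ (signum-* (ℤ.sign i) (ℤ.sign j)) (fromℕ-* ℤ.∣ i ∣ ℤ.∣ j ∣) ⟩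
    (a * b) * (c * d)                ≡⟨ *-interchange a b c d ⟩
    (a * c) * (b * d)                ≡⟨ sym (cong₂ _*_ (absolute i) (absolute j)) ⟩
    fromℤ i * fromℤ j                ∎
    where
    a = signum (ℤ.sign i)
    b = signum (ℤ.sign j)
    c = fromℕ ℤ.∣ i ∣
    d = fromℕ ℤ.∣ j ∣
    absolute : ∀ k → fromℤ k ≡ signum (ℤ.sign k) * fromℕ ℤ.∣ k ∣
    absolute k = trans (cong fromℤ (sym (ℤP.◃-inverse k))) (fromℤ-◃ (ℤ.sign k) ℤ.∣ k ∣)

  -- The embedding sends 0 and 1 to
  -- 0r and 1r on the nose (fromℤ 1 is only propositionally 1r), so the solver's
  -- normal forms match goals written with 0r and 1r.
  embed : ℤ.ℤ → R
  embed (pos zero) = 0r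
  embed (pos (suc zero)) = 1r
  embed i = fromℤ i

  embed≡fromℤ : ∀ i → embed i ≡ fromℤ i
  embed≡fromℤ (pos zero) = refl
  embed≡fromℤ (pos (suc zero)) = sym (+-identityʳ _)
  embed≡fromℤ (pos (suc (suc n))) = refl
  embed≡fromℤ -[1+ n ] = refl

  embedding : ℤ.+-*-rawRing -Raw-AlmostCommutative⟶ fromCommutativeRing commutativeRing
  embedding = record
    { ⟦_⟧ = embed
    ; +-homo = λ i j → homomorphic (i ℤ.+ j) (fromℤ-+ i j) (cong₂ _+_ (embed≡fromℤ i) (embed≡fromℤ j))
    ; *-homo = λ i j → homomorphic (i ℤ.* j) (fromℤ-* i j) (cong₂ _*_ (embed≡fromℤ i) (embed≡fromℤ j))
    ; -‿homo = λ i → homomorphic (ℤ.- i) (fromℤ-neg i) (cong -_ (embed≡fromℤ i))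
    ; 0-homo = refl
    ; 1-homo = refl
    }
    where
    homomorphic : ∀ k {x y} → fromℤ k ≡ x → y ≡ x → embed k ≡ y
    homomorphic k e e′ = trans (embed≡fromℤ k) (trans e (sym e′))

  decideEmbedded : ∀ i j → Maybe (embed i ≡ embed j)
  decideEmbedded i j with i ℤ.≟ j
  ... | yes i≡j = just (cong embed i≡j)
  ... | no _ = nothing

  open import Algebra.Solver.Ring ℤ.+-*-rawRing (fromCommutativeRing commutativeRing) embedding decideEmbedded
    public using (solve; _:=_; _:+_; _:*_; :-_; _:-_; con)

  noZeroDivisors : ∀ {x y} → x * y ≡ 0r → x ≢ 0r → y ≡ 0r
  noZeroDivisors {x} {y} xy≡0 x≢0 with inverse x x≢0
  ... | x⁻¹ , xx⁻¹≡1 = begin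
    y                ≡⟨ sym (*-identityˡ y) ⟩
    1r * y           ≡⟨ cong (_* y) (sym xx⁻¹≡1) ⟩
    (x * x⁻¹) * y    ≡⟨ solve 3 (λ x y x⁻¹ → (x :* x⁻¹) :* y := x⁻¹ :* (x :* y)) refl x y x⁻¹ ⟩
    x⁻¹ * (x * y)    ≡⟨ cong (x⁻¹ *_) xy≡0 ⟩
    x⁻¹ * 0r         ≡⟨ zeroʳ x⁻¹ ⟩
    0r               ∎

  difference≡0 : ∀ {x y} → x - y ≡ 0r → x ≡ y
  difference≡0 {x} {y} x-y≡0 = begin
    x              ≡⟨ solve 2 (λ x y → x := (x :- y) :+ y) refl x y ⟩
    (x - y) + y    ≡⟨ cong (_+ y) x-y≡0 ⟩
    0r + y         ≡⟨ +-identityˡ y ⟩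
    y              ∎

  equal⇒difference≡0 : ∀ {x y} → x ≡ y → x - y ≡ 0r
  equal⇒difference≡0 {x} refl = -‿inverseʳ x

  squareRoots : ∀ u v → u * u ≡ v * v → u ≡ v ⊎ u ≡ - v
  squareRoots u v u²≡v² with (u - v) ≟R 0r
  ... | yes u-v≡0 = inj₁ (difference≡0 u-v≡0)
  ... | no u-v≢0 = inj₂ (difference≡0 (trans (solve 2 (λ u v → u :- :- v := u :+ v) refl u v) u+v≡0))
    where
    u+v≡0 : u + v ≡ 0r
    u+v≡0 = noZeroDivisors
      (trans (solve 2 (λ u v → (u :- v) :* (u :+ v) := u :* u :- v :* v) refl u v)
             (equal⇒difference≡0 u²≡v²))
      u-v≢0

  negate-< : ∀ {x y} → x < y → - y < - x
  negate-< {x} {y} x<y = subst₂ _<_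
    (solve 2 (λ x y → x :+ (:- x :+ :- y) := :- y) refl x y)
    (solve 2 (λ x y → y :+ (:- x :+ :- y) := :- x) refl x y)
    (+-mono-< (- x + - y) x<y)

  0<x⇒-x<0 : ∀ {x} → 0r < x → - x < 0r
  0<x⇒-x<0 {x} 0<x = subst (- x <_) ε⁻¹≈ε (negate-< 0<x)

  x<0⇒0<-x : ∀ {x} → x < 0r → 0r < - x
  x<0⇒0<-x {x} x<0 = subst (_< - x) ε⁻¹≈ε (negate-< x<0)

  0<1 : 0r < 1r
  0<1 with compare 0r 1r
  ... | tri< 0<1 _ _ = 0<1
  ... | tri≈ _ 0≡1 _ = ⊥-elim (0≢1 0≡1)
  ... | tri> _ _ 1<0 = ⊥-elim (asym 1<0 (subst (0r <_) (solve 0 (:- con (pos 1) :* :- con (pos 1) := con (pos 1)) refl)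
                                                    (*-pos (x<0⇒0<-x 1<0) (x<0⇒0<-x 1<0))))

  0<+ : ∀ {x y} → 0r < x → 0r < y → 0r < x + y
  0<+ {x} {y} 0<x 0<y = <-trans 0<y (subst (_< x + y) (+-identityˡ y) (+-mono-< y 0<x))

  0<fromℕ : ∀ n → 0r < fromℕ (suc n)
  0<fromℕ zero = subst (0r <_) (sym (+-identityʳ 1r)) 0<1
  0<fromℕ (suc n) = 0<+ 0<1 (0<fromℕ n)

  fromℕ≢0 : ∀ n → fromℕ (suc n) ≢ 0r
  fromℕ≢0 n eq = irrefl (sym eq) (0<fromℕ n)

  0<square : ∀ {x} → x ≢ 0r → 0r < x * x
  0<square {x} x≢0 with compare x 0r
  ... | tri< x<0 _ _ = subst (0r <_) (solve 1 (λ x → :- x :* :- x := x :* x) refl x) (*-pos (x<0⇒0<-x x<0) (x<0⇒0<-x x<0))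
  ... | tri≈ _ x≡0 _ = ⊥-elim (x≢0 x≡0)
  ... | tri> _ _ 0<x = *-pos 0<x 0<x

  *-cancelʳ-fromℕ : ∀ {x y} k → x * fromℕ (suc k) ≡ y * fromℕ (suc k) → x ≡ y
  *-cancelʳ-fromℕ {x} {y} k xK≡yK = difference≡0 (noZeroDivisors
    (trans (solve 3 (λ x y K → K :* (x :- y) := x :* K :- y :* K) refl x y (fromℕ (suc k))) (equal⇒difference≡0 xK≡yK))
    (fromℕ≢0 k))

module Fractions (ℝ : RealField) where
  open RealField ℝ
  open RealArithmetic ℝ
  open import Data.Nat as ℕ using (ℕ; zero; suc)
  open import Data.Integer as ℤ using (ℤ; -[1+_]) renaming (+_ to pos)
  open import Data.Integer.GCD using (gcd)
  open import Data.Rational as ℚ using (_/_; ↥_; ↧_)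
  import Data.Rational.Properties as ℚP
  open import Data.Empty using (⊥-elim)
  open import Data.Sum using (_⊎_; inj₁; inj₂)
  open import Relation.Binary.Definitions using (tri<; tri≈; tri>)
  open import Relation.Binary.PropositionalEquality
  open ≡-Reasoning

  -- x is a quotient of an integer by a positive integer. This is equivalent
  -- to IsRational (see below) but needs no normalisation, so closure under
  -- the field operations is direct.
  Fraction : R → Set
  Fraction x = Σ ℤ λ i → Σ ℕ λ m → x * fromℕ (suc m) ≡ fromℤ i

  fraction-ℤ : ∀ i → Fraction (fromℤ i)
  fraction-ℤ i = i , 0 , solve 1 (λ a → a :* (con (pos 1) :+ con (pos 0)) := a) refl (fromℤ i)

  fraction-ℕ : ∀ n → Fraction (fromℕ n)
  fraction-ℕ n = fraction-ℤ (pos n)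

  fraction-1 : Fraction 1r
  fraction-1 = subst Fraction (+-identityʳ 1r) (fraction-ℕ 1)

  fraction-neg : ∀ {x} → Fraction x → Fraction (- x)
  fraction-neg {x} (i , m , xX≡i) = ℤ.- i , m , (begin
    - x * fromℕ (suc m)    ≡⟨ solve 2 (λ x X → :- x :* X := :- (x :* X)) refl x (fromℕ (suc m)) ⟩
    - (x * fromℕ (suc m))  ≡⟨ cong -_ xX≡i ⟩
    - fromℤ i              ≡⟨ sym (fromℤ-neg i) ⟩
    fromℤ (ℤ.- i)          ∎)

  fraction-+ : ∀ {x y} → Fraction x → Fraction y → Fraction (x + y)
  fraction-+ {x} {y} (i , m , xX≡i) (j , n , yY≡j) =
    i ℤ.* pos (suc n) ℤ.+ j ℤ.* pos (suc m) , n ℕ.+ m ℕ.* suc n , (begin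
      (x + y) * fromℕ (suc m ℕ.* suc n)  ≡⟨ cong ((x + y) *_) (fromℕ-* (suc m) (suc n)) ⟩
      (x + y) * (X * Y)                  ≡⟨ solve 4 (λ x y X Y → (x :+ y) :* (X :* Y) := (x :* X) :* Y :+ (y :* Y) :* X) refl x y X Y ⟩
      (x * X) * Y + (y * Y) * X          ≡⟨ cong₂ (λ a b → a * Y + b * X) xX≡i yY≡j ⟩
      fromℤ i * Y + fromℤ j * X          ≡⟨ sym (cong₂ _+_ (fromℤ-* i (pos (suc n))) (fromℤ-* j (pos (suc m)))) ⟩
      fromℤ (i ℤ.* pos (suc n)) + fromℤ (j ℤ.* pos (suc m))
                                         ≡⟨ sym (fromℤ-+ (i ℤ.* pos (suc n)) (j ℤ.* pos (suc m))) ⟩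
      fromℤ (i ℤ.* pos (suc n) ℤ.+ j ℤ.* pos (suc m)) ∎)
    where
    X = fromℕ (suc m)
    Y = fromℕ (suc n)

  fraction-- : ∀ {x y} → Fraction x → Fraction y → Fraction (x - y)
  fraction-- fx fy = fraction-+ fx (fraction-neg fy)

  fraction-* : ∀ {x y} → Fraction x → Fraction y → Fraction (x * y)
  fraction-* {x} {y} (i , m , xX≡i) (j , n , yY≡j) = i ℤ.* j , n ℕ.+ m ℕ.* suc n , (begin
    (x * y) * fromℕ (suc m ℕ.* suc n)  ≡⟨ cong ((x * y) *_) (fromℕ-* (suc m) (suc n)) ⟩
    (x * y) * (X * Y)                  ≡⟨ solve 4 (λ x y X Y → (x :* y) :* (X :* Y) := (x :* X) :* (y :* Y)) refl x y X Y ⟩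
    (x * X) * (y * Y)                  ≡⟨ cong₂ _*_ xX≡i yY≡j ⟩
    fromℤ i * fromℤ j                  ≡⟨ sym (fromℤ-* i j) ⟩
    fromℤ (i ℤ.* j)                    ∎)
    where
    X = fromℕ (suc m)
    Y = fromℕ (suc n)

  fraction-÷ : ∀ {x y} k → Fraction x → y * fromℕ (suc k) ≡ x → Fraction y
  fraction-÷ {x} {y} k (i , m , xX≡i) yK≡x = i , k ℕ.+ m ℕ.* suc k , (begin
    y * fromℕ (suc m ℕ.* suc k)  ≡⟨ cong (y *_) (fromℕ-* (suc m) (suc k)) ⟩
    y * (X * K)                  ≡⟨ solve 3 (λ y X K → y :* (X :* K) := (y :* K) :* X) refl y X K ⟩
    (y * K) * X                  ≡⟨ cong (_* X) yK≡x ⟩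
    x * X                        ≡⟨ xX≡i ⟩
    fromℤ i                      ∎)
    where
    X = fromℕ (suc m)
    K = fromℕ (suc k)

  -- The inverse of a fraction is a fraction: from x·X = i and x·y = 1 we get
  -- y·i = X, so y = X / i after moving the sign of i into the numerator.
  fraction-inverse : ∀ {x y} → Fraction x → x * y ≡ 1r → Fraction y
  fraction-inverse {x} {y} (i , m , xX≡i) xy≡1 = invert i yi≡X
    where
    X = fromℕ (suc m)
    yi≡X : y * fromℤ i ≡ X
    yi≡X = begin
      y * fromℤ i    ≡⟨ cong (y *_) (sym xX≡i) ⟩
      y * (x * X)    ≡⟨ solve 3 (λ x y X → y :* (x :* X) := X :* (x :* y)) refl x y X ⟩
      X * (x * y)    ≡⟨ cong (X *_) xy≡1 ⟩
      X * 1r         ≡⟨ *-identityʳ X ⟩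
      X              ∎
    invert : ∀ j → y * fromℤ j ≡ X → Fraction y
    invert (pos zero) y0≡X = ⊥-elim (fromℕ≢0 m (trans (sym y0≡X) (zeroʳ y)))
    invert (pos (suc k)) yK≡X = pos (suc m) , k , yK≡X
    invert -[1+ k ] y[-K]≡X = -[1+ m ] , k ,
      trans (solve 2 (λ y K → y :* K := :- (y :* :- K)) refl y (fromℕ (suc k))) (cong -_ y[-K]≡X)

  fraction-positive : ∀ {x} → Fraction x → 0r < x → Σ ℕ λ e → Σ ℕ λ m → x * fromℕ (suc m) ≡ fromℕ (suc e)
  fraction-positive {x} (i , m , xX≡i) 0<x = positive i xX≡i (subst (0r <_) xX≡i (*-pos 0<x (0<fromℕ m)))
    where
    positive : ∀ j → x * fromℕ (suc m) ≡ fromℤ j → 0r < fromℤ j → Σ ℕ λ e → Σ ℕ λ m → x * fromℕ (suc m) ≡ fromℕ (suc e)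
    positive (pos zero) _ 0<0 = ⊥-elim (irrefl refl 0<0)
    positive (pos (suc e)) xX≡E _ = e , m , xX≡E
    positive -[1+ k ] _ 0<-K = ⊥-elim (asym 0<-K (0<x⇒-x<0 (0<fromℕ k)))

  fraction⇒rational : ∀ {x} → Fraction x → IsRational x
  fraction⇒rational {x} (i , m , xX≡i) = q , difference≡0 (noZeroDivisors G[xD-N]≡0 G≢0)
    where
    q = i / suc m
    g = gcd i (pos (suc m))
    G = fromℤ g
    N = fromℤ (↥ q)
    D = fromℤ (↧ q)
    NG≡i : N * G ≡ fromℤ i
    NG≡i = trans (sym (fromℤ-* (↥ q) g)) (cong fromℤ (ℚP.↥-/ i (suc m)))
    DG≡X : D * G ≡ fromℕ (suc m)
    DG≡X = trans (sym (fromℤ-* (↧ q) g)) (cong fromℤ (ℚP.↧-/ i (suc m)))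
    G≢0 : G ≢ 0r
    G≢0 G≡0 = fromℕ≢0 m (trans (sym DG≡X) (trans (cong (D *_) G≡0) (zeroʳ D)))
    G[xD-N]≡0 : G * (x * D - N) ≡ 0r
    G[xD-N]≡0 = begin
      G * (x * D - N)                ≡⟨ solve 4 (λ G x D N → G :* (x :* D :- N) := x :* (D :* G) :- N :* G) refl G x D N ⟩
      x * (D * G) - N * G            ≡⟨ cong₂ (λ a b → x * a - b) DG≡X NG≡i ⟩
      x * fromℕ (suc m) - fromℤ i    ≡⟨ equal⇒difference≡0 xX≡i ⟩
      0r                             ∎

  rational⇒fraction : ∀ {x} → IsRational x → Fraction x
  rational⇒fraction (q , x≈q) = ↥ q , ℚ.ℚ.denominator-1 q , x≈q

  fraction-± : ∀ {u v} → Fraction v → u ≡ v ⊎ u ≡ - v → Fraction u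
  fraction-± fv (inj₁ u≡v) = subst Fraction (sym u≡v) fv
  fraction-± fv (inj₂ u≡-v) = subst Fraction (sym u≡-v) (fraction-neg fv)

  unitSign : ∀ x → Σ R λ σ → σ * σ ≡ 1r × 0r ≤ σ * x × Fraction σ
  unitSign x with compare 0r x
  ... | tri< 0<x _ _ = 1r , *-identityˡ 1r , inj₁ (subst (0r <_) (sym (*-identityˡ x)) 0<x) , fraction-1
  ... | tri≈ _ 0≡x _ = 1r , *-identityˡ 1r , inj₂ (trans 0≡x (sym (*-identityˡ x))) , fraction-1
  ... | tri> _ _ x<0 = - 1r , solve 0 (:- con (pos 1) :* :- con (pos 1) := con (pos 1)) refl ,
    inj₁ (subst (0r <_) (solve 1 (λ x → :- x := :- con (pos 1) :* x) refl x) (x<0⇒0<-x x<0)) ,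
    fraction-neg fraction-1

module PlaneGeometry (ℝ : RealField) where
  open RealField ℝ
  open RealArithmetic ℝ
  open Fractions ℝ
  open import Data.Integer using () renaming (+_ to pos)
  open import Data.Product using (proj₁; proj₂)
  open import Data.Empty using (⊥-elim)
  open import Relation.Nullary using (Dec; yes; no)
  open import Relation.Binary.PropositionalEquality
  open ≡-Reasoning

  -- Twice the signed area of the triangle abp; Collinear a b p says it vanishes.
  cross : Point → Point → Point → R
  cross (x₁ , y₁) (x₂ , y₂) (x₃ , y₃) = (x₂ - x₁) * (y₃ - y₁) - (y₂ - y₁) * (x₃ - x₁)

  collinear? : ∀ u v w → Dec (Collinear u v w)
  collinear? u v w = _ ≟R _

  -- If u ≠ v, three points on the line uv are collinear. The cross product of
  -- p₁ p₂ p₃, scaled by either coordinate of v - u, is a combination of the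
  -- (vanishing) cross products u v pᵢ.
  collinear-on-line : ∀ u v p₁ p₂ p₃ → u ≢ v →
    Collinear u v p₁ → Collinear u v p₂ → Collinear u v p₃ → Collinear p₁ p₂ p₃
  collinear-on-line (u₁ , u₂) (v₁ , v₂) (x₁ , y₁) (x₂ , y₂) (x₃ , y₃) u≢v c₁ c₂ c₃ =
    difference≡0 (vanishes ((v₁ - u₁) ≟R 0r) ((v₂ - u₂) ≟R 0r))
    where
    C = (x₂ - x₁) * (y₃ - y₁) - (y₂ - y₁) * (x₃ - x₁)
    line : R → R → R
    line x y = (v₁ - u₁) * (y - u₂) - (v₂ - u₂) * (x - u₁)
    combination₁ : (v₁ - u₁) * C ≡ line x₃ y₃ * (x₂ - x₁) - line x₂ y₂ * (x₃ - x₁) + line x₁ y₁ * (x₃ - x₂)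
    combination₁ = solve 10 (λ u₁ u₂ v₁ v₂ x₁ y₁ x₂ y₂ x₃ y₃ →
      let line = λ x y → (v₁ :- u₁) :* (y :- u₂) :- (v₂ :- u₂) :* (x :- u₁) in
      (v₁ :- u₁) :* ((x₂ :- x₁) :* (y₃ :- y₁) :- (y₂ :- y₁) :* (x₃ :- x₁)) :=
      line x₃ y₃ :* (x₂ :- x₁) :- line x₂ y₂ :* (x₃ :- x₁) :+ line x₁ y₁ :* (x₃ :- x₂))
      refl u₁ u₂ v₁ v₂ x₁ y₁ x₂ y₂ x₃ y₃
    combination₂ : (v₂ - u₂) * C ≡ line x₃ y₃ * (y₂ - y₁) - line x₂ y₂ * (y₃ - y₁) + line x₁ y₁ * (y₃ - y₂)
    combination₂ = solve 10 (λ u₁ u₂ v₁ v₂ x₁ y₁ x₂ y₂ x₃ y₃ →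
      let line = λ x y → (v₁ :- u₁) :* (y :- u₂) :- (v₂ :- u₂) :* (x :- u₁) in
      (v₂ :- u₂) :* ((x₂ :- x₁) :* (y₃ :- y₁) :- (y₂ :- y₁) :* (x₃ :- x₁)) :=
      line x₃ y₃ :* (y₂ :- y₁) :- line x₂ y₂ :* (y₃ :- y₁) :+ line x₁ y₁ :* (y₃ :- y₂))
      refl u₁ u₂ v₁ v₂ x₁ y₁ x₂ y₂ x₃ y₃
    combination-vanishes : ∀ w₁ w₂ w₃ → line x₃ y₃ * w₁ - line x₂ y₂ * w₂ + line x₁ y₁ * w₃ ≡ 0r
    combination-vanishes w₁ w₂ w₃ = begin
      line x₃ y₃ * w₁ - line x₂ y₂ * w₂ + line x₁ y₁ * w₃
        ≡⟨ cong₂ (λ a b → a * w₁ - b * w₂ + line x₁ y₁ * w₃) (equal⇒difference≡0 c₃) (equal⇒difference≡0 c₂) ⟩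
      0r * w₁ - 0r * w₂ + line x₁ y₁ * w₃
        ≡⟨ cong (λ c → 0r * w₁ - 0r * w₂ + c * w₃) (equal⇒difference≡0 c₁) ⟩
      0r * w₁ - 0r * w₂ + 0r * w₃
        ≡⟨ solve 3 (λ a b c → con (pos 0) :* a :- con (pos 0) :* b :+ con (pos 0) :* c := con (pos 0)) refl w₁ w₂ w₃ ⟩
      0r ∎
    vanishes : Dec (v₁ - u₁ ≡ 0r) → Dec (v₂ - u₂ ≡ 0r) → C ≡ 0r
    vanishes (no v₁-u₁≢0) _ = noZeroDivisors (trans combination₁ (combination-vanishes _ _ _)) v₁-u₁≢0
    vanishes (yes _) (no v₂-u₂≢0) = noZeroDivisors (trans combination₂ (combination-vanishes _ _ _)) v₂-u₂≢0
    vanishes (yes v₁-u₁≡0) (yes v₂-u₂≡0) =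
      ⊥-elim (u≢v (cong₂ _,_ (sym (difference≡0 v₁-u₁≡0)) (sym (difference≡0 v₂-u₂≡0))))

  1+1≢0 : 1r + 1r ≢ 0r
  1+1≢0 1+1≡0 = irrefl (sym 1+1≡0) (0<+ 0<1 0<1)

  half : R
  half = proj₁ (inverse (1r + 1r) 1+1≢0)

  half+half : ∀ s → half * s + half * s ≡ s
  half+half s = begin
    half * s + half * s     ≡⟨ solve 2 (λ h s → h :* s :+ h :* s := ((con (pos 1) :+ con (pos 1)) :* h) :* s) refl half s ⟩
    ((1r + 1r) * half) * s  ≡⟨ cong (_* s) (proj₂ (inverse (1r + 1r) 1+1≢0)) ⟩
    1r * s                  ≡⟨ *-identityˡ s ⟩
    s                       ∎

  midpoint : Point → Point → Point
  midpoint (x₁ , y₁) (x₂ , y₂) = half * (x₁ + x₂) , half * (y₁ + y₂)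

  midpoint-isMidpoint : ∀ q r → IsMidpoint q r (midpoint q r)
  midpoint-isMidpoint q r = cong₂ _,_ (half+half _) (half+half _)

  -- Four times the squared median from p in the triangle pqr: since m + m = q + r
  -- for the midpoint m, it is the squared distance from p + p to q + r.
  fourMedian² : Point → Point → Point → R
  fourMedian² p q r = sqDist (p ⊕ p) (q ⊕ r)

  sqDist-double : ∀ p m → sqDist (p ⊕ p) (m ⊕ m) ≡ fromℕ 4 * sqDist p m
  sqDist-double (x₁ , y₁) (x₂ , y₂) = solve 4 (λ x₁ y₁ x₂ y₂ →
    ((x₁ :+ x₁) :- (x₂ :+ x₂)) :* ((x₁ :+ x₁) :- (x₂ :+ x₂)) :+ ((y₁ :+ y₁) :- (y₂ :+ y₂)) :* ((y₁ :+ y₁) :- (y₂ :+ y₂))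
      := con (pos 4) :* ((x₁ :- x₂) :* (x₁ :- x₂) :+ (y₁ :- y₂) :* (y₁ :- y₂))) refl x₁ y₁ x₂ y₂

  rationalLength⇒fraction : ∀ {p q} → RationalLength p q → Fraction (sqDist p q)
  rationalLength⇒fraction (ℓ , (_ , ℓ²≡pq²) , ℓ-rational) = subst Fraction ℓ²≡pq² (fraction-* ℓ-fraction ℓ-fraction)
    where
    ℓ-fraction = rational⇒fraction ℓ-rational

  median-fraction : ∀ p q r → RationalMedian p q r → Fraction (fourMedian² p q r)
  median-fraction p q r rational-median = subst Fraction four-times
    (fraction-* (fraction-ℕ 4) (rationalLength⇒fraction (rational-median m (midpoint-isMidpoint q r))))
    where
    m = midpoint q r
    four-times : fromℕ 4 * sqDist p m ≡ fourMedian² p q r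
    four-times = trans (sym (sqDist-double p m)) (cong (sqDist (p ⊕ p)) (midpoint-isMidpoint q r))

  side-from-medians : ∀ u v w → sqDist u v * fromℕ 9 ≡
    (fourMedian² u v w + fourMedian² u v w) + (fourMedian² v w u + fourMedian² v w u) - fourMedian² w u v
  side-from-medians (u₁ , u₂) (v₁ , v₂) (w₁ , w₂) = solve 6 (λ u₁ u₂ v₁ v₂ w₁ w₂ →
    let sq = λ a b → a :* a :+ b :* b
        Mu = sq ((u₁ :+ u₁) :- (v₁ :+ w₁)) ((u₂ :+ u₂) :- (v₂ :+ w₂))
        Mv = sq ((v₁ :+ v₁) :- (w₁ :+ u₁)) ((v₂ :+ v₂) :- (w₂ :+ u₂))
        Mw = sq ((w₁ :+ w₁) :- (u₁ :+ v₁)) ((w₂ :+ w₂) :- (u₂ :+ v₂))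
    in sq (u₁ :- v₁) (u₂ :- v₂) :* con (pos 9) := (Mu :+ Mu) :+ (Mv :+ Mv) :- Mw) refl u₁ u₂ v₁ v₂ w₁ w₂

  triangle-side-fraction : ∀ u v w → RationalMedian u v w → RationalMedian v w u → RationalMedian w u v →
    Fraction (sqDist u v)
  triangle-side-fraction u v w mu mv mw = fraction-÷ 8
    (fraction-- (fraction-+ (fraction-+ Mu Mu) (fraction-+ Mv Mv)) (median-fraction w u v mw))
    (side-from-medians u v w)
    where
    Mu = median-fraction u v w mu
    Mv = median-fraction v w u mv

  -- Twice the dot product (b - a)·(d - c), recovered from squared distances.
  polar : Point → Point → Point → Point → R
  polar a b c d = sqDist b c + sqDist a d - sqDist b d - sqDist a c

  -- Binet–Cauchy in the plane: a product of two cross products is the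
  -- determinant of the matrix of dot products of their edge vectors.
  binet-cauchy : ∀ a b p c d f →
    (cross a b p * cross c d f) * fromℕ 4 ≡ polar a b c d * polar a p c f - polar a b c f * polar a p c d
  binet-cauchy (a₁ , a₂) (b₁ , b₂) (p₁ , p₂) (c₁ , c₂) (d₁ , d₂) (f₁ , f₂) =
    solve 12 (λ a₁ a₂ b₁ b₂ p₁ p₂ c₁ c₂ d₁ d₂ f₁ f₂ →
      let cross = λ x₁ y₁ x₂ y₂ x₃ y₃ → (x₂ :- x₁) :* (y₃ :- y₁) :- (y₂ :- y₁) :* (x₃ :- x₁)
          sd = λ x₁ y₁ x₂ y₂ → (x₁ :- x₂) :* (x₁ :- x₂) :+ (y₁ :- y₂) :* (y₁ :- y₂)
          polar = λ x₁ y₁ x₂ y₂ x₃ y₃ x₄ y₄ → sd x₂ y₂ x₃ y₃ :+ sd x₁ y₁ x₄ y₄ :- sd x₂ y₂ x₄ y₄ :- sd x₁ y₁ x₃ y₃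
      in (cross a₁ a₂ b₁ b₂ p₁ p₂ :* cross c₁ c₂ d₁ d₂ f₁ f₂) :* con (pos 4) :=
         polar a₁ a₂ b₁ b₂ c₁ c₂ d₁ d₂ :* polar a₁ a₂ p₁ p₂ c₁ c₂ f₁ f₂
           :- polar a₁ a₂ b₁ b₂ c₁ c₂ f₁ f₂ :* polar a₁ a₂ p₁ p₂ c₁ c₂ d₁ d₂)
      refl a₁ a₂ b₁ b₂ p₁ p₂ c₁ c₂ d₁ d₂ f₁ f₂

  first-coordinate : ∀ P → proj₁ P * fromℕ 2 ≡ polar origin e₁ origin P
  first-coordinate (x , y) = solve 2 (λ x y →
    let sd = λ x₁ y₁ x₂ y₂ → (x₁ :- x₂) :* (x₁ :- x₂) :+ (y₁ :- y₂) :* (y₁ :- y₂)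
        O = con (pos 0) ; I = con (pos 1)
    in x :* con (pos 2) := sd I O O O :+ sd O O x y :- sd I O x y :- sd O O O O) refl x y

  second-coordinate : ∀ P → cross origin e₁ P ≡ proj₂ P
  second-coordinate (x , y) = solve 2 (λ x y →
    let O = con (pos 0) ; I = con (pos 1)
    in (I :- O) :* (y :- O) :- (O :- O) :* (x :- O) := y) refl x y

  ScalesBy : (Point → Point) → R → Set
  ScalesBy T cc = ∀ u v → sqDist (T u) (T v) ≡ cc * sqDist u v

  similarity-scales : ∀ {T} → IsSimilarity T → Σ R (ScalesBy T)
  similarity-scales {T} (f , c , isometry , _ , T≡c·f) = c * c , λ u v → begin
    sqDist (T u) (T v)            ≡⟨ cong₂ sqDist (T≡c·f u) (T≡c·f v) ⟩
    sqDist (c · f u) (c · f v)    ≡⟨ sqDist-· (f u) (f v) ⟩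
    (c * c) * sqDist (f u) (f v)  ≡⟨ cong ((c * c) *_) (isometry u v) ⟩
    (c * c) * sqDist u v          ∎
    where
    sqDist-· : ∀ P Q → sqDist (c · P) (c · Q) ≡ (c * c) * sqDist P Q
    sqDist-· (x₁ , y₁) (x₂ , y₂) = solve 5 (λ c x₁ y₁ x₂ y₂ →
      (c :* x₁ :- c :* x₂) :* (c :* x₁ :- c :* x₂) :+ (c :* y₁ :- c :* y₂) :* (c :* y₁ :- c :* y₂)
        := (c :* c) :* ((x₁ :- x₂) :* (x₁ :- x₂) :+ (y₁ :- y₂) :* (y₁ :- y₂))) refl c x₁ y₁ x₂ y₂

  -- A map scaling squared distances by cc scales dot products by cc and
  -- (by Binet–Cauchy) squared cross products by cc².
  module Scaling {T : Point → Point} {cc : R} (scales : ScalesBy T cc) where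

    polar-scale : ∀ a b c d → polar (T a) (T b) (T c) (T d) ≡ cc * polar a b c d
    polar-scale a b c d = begin
      polar (T a) (T b) (T c) (T d)
        ≡⟨ cong₂ _-_ (cong₂ _-_ (cong₂ _+_ (scales b c) (scales a d)) (scales b d)) (scales a c) ⟩
      cc * sqDist b c + cc * sqDist a d - cc * sqDist b d - cc * sqDist a c
        ≡⟨ solve 5 (λ k s t u v → k :* s :+ k :* t :- k :* u :- k :* v := k :* (s :+ t :- u :- v))
                 refl cc (sqDist b c) (sqDist a d) (sqDist b d) (sqDist a c) ⟩
      cc * polar a b c d ∎

    cross²-scale : ∀ a b p →
      cross (T a) (T b) (T p) * cross (T a) (T b) (T p) ≡ (cc * cross a b p) * (cc * cross a b p)
    cross²-scale a b p = *-cancelʳ-fromℕ 3 (begin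
      (cross (T a) (T b) (T p) * cross (T a) (T b) (T p)) * fromℕ 4
        ≡⟨ binet-cauchy (T a) (T b) (T p) (T a) (T b) (T p) ⟩
      polar (T a) (T b) (T a) (T b) * polar (T a) (T p) (T a) (T p)
        - polar (T a) (T b) (T a) (T p) * polar (T a) (T p) (T a) (T b)
        ≡⟨ cong₂ _-_ (cong₂ _*_ (polar-scale a b a b) (polar-scale a p a p))
                     (cong₂ _*_ (polar-scale a b a p) (polar-scale a p a b)) ⟩
      (cc * polar a b a b) * (cc * polar a p a p) - (cc * polar a b a p) * (cc * polar a p a b)
        ≡⟨ solve 5 (λ k s t u v → (k :* s) :* (k :* t) :- (k :* u) :* (k :* v) := (k :* k) :* (s :* t :- u :* v))
                 refl cc (polar a b a b) (polar a p a p) (polar a b a p) (polar a p a b) ⟩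
      (cc * cc) * (polar a b a b * polar a p a p - polar a b a p * polar a p a b)
        ≡⟨ cong ((cc * cc) *_) (sym (binet-cauchy a b p a b p)) ⟩
      (cc * cc) * ((cross a b p * cross a b p) * fromℕ 4)
        ≡⟨ solve 3 (λ k D F → (k :* k) :* ((D :* D) :* F) := ((k :* D) :* (k :* D)) :* F)
                 refl cc (cross a b p) (fromℕ 4) ⟩
      ((cc * cross a b p) * (cc * cross a b p)) * fromℕ 4 ∎)

    module Frame {a b} (Ta≡O : T a ≡ origin) (Tb≡e₁ : T b ≡ e₁) where

      frame-scale : sqDist a b * cc ≡ 1r
      frame-scale = begin
        sqDist a b * cc        ≡⟨ *-comm _ cc ⟩
        cc * sqDist a b        ≡⟨ sym (scales a b) ⟩
        sqDist (T a) (T b)     ≡⟨ cong₂ sqDist Ta≡O Tb≡e₁ ⟩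
        sqDist origin e₁       ≡⟨ solve 0 ((con (pos 0) :- con (pos 1)) :* (con (pos 0) :- con (pos 1))
                                            :+ (con (pos 0) :- con (pos 0)) :* (con (pos 0) :- con (pos 0)) := con (pos 1)) refl ⟩
        1r                     ∎

      frame-x : ∀ p → proj₁ (T p) * fromℕ 2 ≡ cc * polar a b a p
      frame-x p = begin
        proj₁ (T p) * fromℕ 2          ≡⟨ first-coordinate (T p) ⟩
        polar origin e₁ origin (T p)   ≡⟨ cong₂ (λ O I → polar O I O (T p)) (sym Ta≡O) (sym Tb≡e₁) ⟩
        polar (T a) (T b) (T a) (T p)  ≡⟨ polar-scale a b a p ⟩
        cc * polar a b a p             ∎

      frame-y² : ∀ p → proj₂ (T p) * proj₂ (T p) ≡ (cc * cross a b p) * (cc * cross a b p)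
      frame-y² p = begin
        proj₂ (T p) * proj₂ (T p)                        ≡⟨ sym (cong₂ _*_ (second-coordinate (T p)) (second-coordinate (T p))) ⟩
        cross origin e₁ (T p) * cross origin e₁ (T p)    ≡⟨ cong (λ (O , I) → cross O I (T p) * cross O I (T p))
                                                                 (sym (cong₂ _,_ Ta≡O Tb≡e₁)) ⟩
        cross (T a) (T b) (T p) * cross (T a) (T b) (T p) ≡⟨ cross²-scale a b p ⟩
        (cc * cross a b p) * (cc * cross a b p)          ∎

module SquareRootClass (ℝ : RealField) where
  open RealField ℝ
  open RealArithmetic ℝ
  open Fractions ℝ
  open SquareFreeDecomposition
  open import Data.Nat as ℕ using (ℕ; suc; s≤s; z≤n)
  open import Data.Nat.Divisibility using (_∣_)
  open import Data.Integer using () renaming (+_ to pos)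
  open import Data.Product using (proj₁; proj₂)
  open import Relation.Binary.PropositionalEquality
  open ≡-Reasoning

  -- A square root s of a square-free K such that Δ·s is a nonzero rational,
  -- i.e. Δ ∈ ℚ·√K.
  record SquareFreeRoot (Δ : R) : Set where
    field
      K            : ℕ
      K-squareFree : ∀ d → d ℕ.* d ∣ K → d ≡ 1
      s            : R
      s²≡K         : s * s ≡ fromℕ K
      Δs-fraction  : Fraction (Δ * s)
      Δs≢0         : Δ * s ≢ 0r

  -- Write Δ² = E / X with positive integers and split E·X = K·M² with K
  -- square-free; then s = Δ·X/M squares to K, and Δ·s = E/M.
  -- Opaque: users only need the fields, and unfolding the construction at use
  -- sites (down to the ring-solver proofs) makes type checking far too costly.
  opaque
    squareFreeRoot : ∀ {Δ} → Δ ≢ 0r → Fraction (Δ * Δ) → SquareFreeRoot Δ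
    squareFreeRoot {Δ} Δ≢0 Δ²-fraction = record
      { K = core ; K-squareFree = core-sqfree ; s = s ; s²≡K = s²≡K
      ; Δs-fraction = subst Fraction (sym Δs≡E/M) (fraction-* (fraction-ℕ (suc e)) M⁻¹-fraction)
      ; Δs≢0 = λ Δs≡0 → E/M≢0 (trans (sym Δs≡E/M) Δs≡0) }
      where
      Δ²-positive : Σ ℕ λ e → Σ ℕ λ m → (Δ * Δ) * fromℕ (suc m) ≡ fromℕ (suc e)
      Δ²-positive = fraction-positive Δ²-fraction (0<square Δ≢0)
      e m : ℕ
      e = proj₁ Δ²-positive
      m = proj₁ (proj₂ Δ²-positive)
      E X : R
      E = fromℕ (suc e)
      X = fromℕ (suc m)
      Δ²X≡E : (Δ * Δ) * X ≡ E
      Δ²X≡E = proj₂ (proj₂ Δ²-positive)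

      open SquareFreeSplitting (splitting (suc e ℕ.* suc m) (s≤s z≤n))
      M M⁻¹ : R
      M = fromℕ cofactor
      M≢0 : M ≢ 0r
      M≢0 with cofactor | cofactor≥1
      ... | suc c | _ = fromℕ≢0 c
      M⁻¹ = proj₁ (inverse M M≢0)
      MM⁻¹≡1 : M * M⁻¹ ≡ 1r
      MM⁻¹≡1 = proj₂ (inverse M M≢0)
      M⁻¹-fraction : Fraction M⁻¹
      M⁻¹-fraction = fraction-inverse (fraction-ℕ cofactor) MM⁻¹≡1

      EX≡KM² : E * X ≡ fromℕ core * (M * M)
      EX≡KM² = begin
        E * X                                       ≡⟨ sym (fromℕ-* (suc e) (suc m)) ⟩
        fromℕ (suc e ℕ.* suc m)                     ≡⟨ cong fromℕ splits ⟩
        fromℕ (core ℕ.* (cofactor ℕ.* cofactor))    ≡⟨ fromℕ-* core _ ⟩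
        fromℕ core * fromℕ (cofactor ℕ.* cofactor)  ≡⟨ cong (fromℕ core *_) (fromℕ-* cofactor cofactor) ⟩
        fromℕ core * (M * M)                        ∎

      s : R
      s = (Δ * X) * M⁻¹
      s²≡K : s * s ≡ fromℕ core
      s²≡K = begin
        s * s                                   ≡⟨ solve 3 (λ Δ X M⁻¹ → ((Δ :* X) :* M⁻¹) :* ((Δ :* X) :* M⁻¹)
                                                       := (((Δ :* Δ) :* X) :* X) :* (M⁻¹ :* M⁻¹)) refl Δ X M⁻¹ ⟩
        (((Δ * Δ) * X) * X) * (M⁻¹ * M⁻¹)       ≡⟨ cong (λ t → (t * X) * (M⁻¹ * M⁻¹)) Δ²X≡E ⟩
        (E * X) * (M⁻¹ * M⁻¹)                   ≡⟨ cong (_* (M⁻¹ * M⁻¹)) EX≡KM² ⟩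
        (fromℕ core * (M * M)) * (M⁻¹ * M⁻¹)    ≡⟨ solve 3 (λ K M M⁻¹ → (K :* (M :* M)) :* (M⁻¹ :* M⁻¹)
                                                       := K :* ((M :* M⁻¹) :* (M :* M⁻¹))) refl (fromℕ core) M M⁻¹ ⟩
        fromℕ core * ((M * M⁻¹) * (M * M⁻¹))    ≡⟨ cong (λ t → fromℕ core * (t * t)) MM⁻¹≡1 ⟩
        fromℕ core * (1r * 1r)                  ≡⟨ solve 1 (λ K → K :* (con (pos 1) :* con (pos 1)) := K) refl (fromℕ core) ⟩
        fromℕ core                              ∎

      Δs≡E/M : Δ * s ≡ E * M⁻¹
      Δs≡E/M = trans (solve 3 (λ Δ X M⁻¹ → Δ :* ((Δ :* X) :* M⁻¹) := ((Δ :* Δ) :* X) :* M⁻¹) refl Δ X M⁻¹)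
                     (cong (_* M⁻¹) Δ²X≡E)
      E/M≢0 : E * M⁻¹ ≢ 0r
      E/M≢0 E/M≡0 = 0≢1 (begin
        0r         ≡⟨ sym (zeroʳ M) ⟩
        M * 0r     ≡⟨ cong (M *_) (sym (noZeroDivisors E/M≡0 (fromℕ≢0 e))) ⟩
        M * M⁻¹    ≡⟨ MM⁻¹≡1 ⟩
        1r         ∎)

  record RationalOver√ (Δ : R) : Set where
    field
      K            : ℕ
      K-squareFree : ∀ d → d ℕ.* d ∣ K → d ≡ 1
      √K           : R
      0≤√K         : 0r ≤ √K
      √K²≡K        : √K * √K ≡ fromℕ K
      over-√K      : ∀ y → Fraction (y * Δ) → Σ R λ r → Fraction r × y ≡ r * √K

  -- Take √K = σ·s for the unit sign σ making it nonnegative; then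
  -- y = (y·Δ)·(Δ·s)⁻¹·σ·√K.
  rationalOver√ : ∀ {Δ} → SquareFreeRoot Δ → RationalOver√ Δ
  rationalOver√ {Δ} root = record
    { K = K ; K-squareFree = K-squareFree ; √K = σ * s ; 0≤√K = 0≤σs ; √K²≡K = √K²≡K
    ; over-√K = λ y yΔ-fraction → ((y * Δ) * [Δs]⁻¹) * σ ,
        fraction-* (fraction-* yΔ-fraction [Δs]⁻¹-fraction) σ-fraction , y≡r√K y }
    where
    open SquareFreeRoot root
    [Δs]⁻¹ : R
    [Δs]⁻¹ = proj₁ (inverse (Δ * s) Δs≢0)
    Δs[Δs]⁻¹≡1 : (Δ * s) * [Δs]⁻¹ ≡ 1r
    Δs[Δs]⁻¹≡1 = proj₂ (inverse (Δ * s) Δs≢0)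
    [Δs]⁻¹-fraction : Fraction [Δs]⁻¹
    [Δs]⁻¹-fraction = fraction-inverse Δs-fraction Δs[Δs]⁻¹≡1

    sign : Σ R λ σ → σ * σ ≡ 1r × 0r ≤ σ * s × Fraction σ
    sign = unitSign s
    σ : R
    σ = proj₁ sign
    σ²≡1 : σ * σ ≡ 1r
    σ²≡1 = proj₁ (proj₂ sign)
    0≤σs : 0r ≤ σ * s
    0≤σs = proj₁ (proj₂ (proj₂ sign))
    σ-fraction : Fraction σ
    σ-fraction = proj₂ (proj₂ (proj₂ sign))

    √K²≡K : (σ * s) * (σ * s) ≡ fromℕ K
    √K²≡K = begin
      (σ * s) * (σ * s)   ≡⟨ solve 2 (λ σ s → (σ :* s) :* (σ :* s) := (σ :* σ) :* (s :* s)) refl σ s ⟩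
      (σ * σ) * (s * s)   ≡⟨ cong₂ _*_ σ²≡1 s²≡K ⟩
      1r * fromℕ K        ≡⟨ *-identityˡ _ ⟩
      fromℕ K             ∎

    y≡r√K : ∀ y → y ≡ (((y * Δ) * [Δs]⁻¹) * σ) * (σ * s)
    y≡r√K y = sym (begin
      (((y * Δ) * [Δs]⁻¹) * σ) * (σ * s)
        ≡⟨ solve 5 (λ y Δ i σ s → (((y :* Δ) :* i) :* σ) :* (σ :* s) := (y :* (σ :* σ)) :* ((Δ :* s) :* i))
             refl y Δ [Δs]⁻¹ σ s ⟩
      (y * (σ * σ)) * ((Δ * s) * [Δs]⁻¹)  ≡⟨ cong₂ (λ a b → (y * a) * b) σ²≡1 Δs[Δs]⁻¹≡1 ⟩
      (y * 1r) * 1r                      ≡⟨ solve 1 (λ y → (y :* con (pos 1)) :* con (pos 1) := y) refl y ⟩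
      y ∎)

module RationalMedianSets (ℝ : RealField) (S : RealField.Point ℝ → Set)
                          (rms : RealField.RationalMedianSet ℝ S) where
  open RealField ℝ
  open RealArithmetic ℝ
  open Fractions ℝ
  open PlaneGeometry ℝ
  open import Data.Integer using () renaming (+_ to pos)
  open import Data.Product using (proj₁; proj₂)
  open import Data.Product.Properties using (≡-dec)
  open import Data.Empty using (⊥-elim)
  open import Relation.Nullary using (¬_; yes; no)
  open import Relation.Binary.PropositionalEquality
  open ≡-Reasoning

  q₁ q₂ q₃ : Point
  q₁ = proj₁ (proj₁ rms)
  q₂ = proj₁ (proj₂ (proj₁ rms))
  q₃ = proj₁ (proj₂ (proj₂ (proj₁ rms)))
  Sq₁ : S q₁
  Sq₁ = proj₁ (proj₂ (proj₂ (proj₂ (proj₁ rms))))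
  Sq₂ : S q₂
  Sq₂ = proj₁ (proj₂ (proj₂ (proj₂ (proj₂ (proj₁ rms)))))
  Sq₃ : S q₃
  Sq₃ = proj₁ (proj₂ (proj₂ (proj₂ (proj₂ (proj₂ (proj₁ rms))))))
  q-noncollinear : ¬ Collinear q₁ q₂ q₃
  q-noncollinear = proj₂ (proj₂ (proj₂ (proj₂ (proj₂ (proj₂ (proj₁ rms))))))

  side-fraction : ∀ {u v w} → S u → S v → S w → ¬ Collinear u v w → Fraction (sqDist u v)
  side-fraction {u} {v} {w} Su Sv Sw uvw-noncollinear with proj₂ rms u v w Su Sv Sw uvw-noncollinear
  ... | mu , mv , mw = triangle-side-fraction u v w mu mv mw

  -- All squared distances within S are rational: two distinct points of S
  -- form a triangle with one of q₁ q₂ q₃, since not all three lie on their line.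
  distance-fraction : ∀ {u v} → S u → S v → Fraction (sqDist u v)
  distance-fraction {u} {v} Su Sv with ≡-dec _≟R_ _≟R_ u v
  ... | yes refl = subst Fraction (sym (sqDist-self u)) (fraction-ℕ 0)
    where
    sqDist-self : ∀ P → sqDist P P ≡ 0r
    sqDist-self (x , y) = solve 2 (λ x y → (x :- x) :* (x :- x) :+ (y :- y) :* (y :- y) := con (pos 0)) refl x y
  ... | no u≢v with collinear? u v q₁ | collinear? u v q₂ | collinear? u v q₃
  ... | no uvq₁ | _ | _ = side-fraction Su Sv Sq₁ uvq₁
  ... | yes _ | no uvq₂ | _ = side-fraction Su Sv Sq₂ uvq₂
  ... | yes _ | yes _ | no uvq₃ = side-fraction Su Sv Sq₃ uvq₃
  ... | yes c₁ | yes c₂ | yes c₃ = ⊥-elim (q-noncollinear (collinear-on-line u v q₁ q₂ q₃ u≢v c₁ c₂ c₃))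

  polar-fraction : ∀ {a b c d} → S a → S b → S c → S d → Fraction (polar a b c d)
  polar-fraction Sa Sb Sc Sd = fraction-- (fraction-- (fraction-+ (distance-fraction Sb Sc) (distance-fraction Sa Sd))
                                                      (distance-fraction Sb Sd))
                                          (distance-fraction Sa Sc)

  -- Δ, twice the signed area of q₁q₂q₃, is the common irrational factor:
  -- every cross product of points of S is a rational multiple of 1/Δ.
  Δ : R
  Δ = cross q₁ q₂ q₃

  Δ≢0 : Δ ≢ 0r
  Δ≢0 Δ≡0 = q-noncollinear (difference≡0 Δ≡0)

  cross-fraction : ∀ {a b p} → S a → S b → S p → Fraction (cross a b p * Δ)
  cross-fraction {a} {b} {p} Sa Sb Sp = fraction-÷ 3
    (fraction-- (fraction-* (polar-fraction Sa Sb Sq₁ Sq₂) (polar-fraction Sa Sp Sq₁ Sq₃))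
                (fraction-* (polar-fraction Sa Sb Sq₁ Sq₃) (polar-fraction Sa Sp Sq₁ Sq₂)))
    (binet-cauchy a b p q₁ q₂ q₃)

  normalised-coordinates : ∀ {T} → IsSimilarity T → ∀ {a b} → S a → S b → T a ≡ origin → T b ≡ e₁ →
    ∀ {p} → S p → Fraction (proj₁ (T p)) × Fraction (proj₂ (T p) * Δ)
  normalised-coordinates {T} similarity {a} {b} Sa Sb Ta≡O Tb≡e₁ {p} Sp =
    fraction-÷ 1 (fraction-* cc-fraction (polar-fraction Sa Sb Sa Sp)) (frame-x p) ,
    fraction-± (fraction-* cc-fraction (cross-fraction Sa Sb Sp)) (squareRoots (y * Δ) (cc * (D * Δ)) [yΔ]²)
    where
    cc = proj₁ (similarity-scales similarity)
    open Scaling (proj₂ (similarity-scales similarity))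
    open Frame Ta≡O Tb≡e₁
    cc-fraction : Fraction cc
    cc-fraction = fraction-inverse (distance-fraction Sa Sb) frame-scale
    y = proj₂ (T p)
    D = cross a b p
    [yΔ]² : (y * Δ) * (y * Δ) ≡ (cc * (D * Δ)) * (cc * (D * Δ))
    [yΔ]² = begin
      (y * Δ) * (y * Δ)                ≡⟨ solve 2 (λ y Δ → (y :* Δ) :* (y :* Δ) := (y :* y) :* (Δ :* Δ)) refl y Δ ⟩
      (y * y) * (Δ * Δ)                ≡⟨ cong (_* (Δ * Δ)) (frame-y² p) ⟩
      ((cc * D) * (cc * D)) * (Δ * Δ)  ≡⟨ solve 3 (λ c D Δ → ((c :* D) :* (c :* D)) :* (Δ :* Δ)
                                            := (c :* (D :* Δ)) :* (c :* (D :* Δ))) refl cc D Δ ⟩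
      (cc * (D * Δ)) * (cc * (D * Δ))  ∎

-- K is the square-free class of Δ²: x-coordinates are rational, and each
-- y-coordinate, being rational over Δ, is a rational multiple of √K.
lemma4p1 : (ℝ : RealField) → let open RealField ℝ in
  (S : Point → Set) → RationalMedianSet S →
  ∃[ k ] (SquareFree k ×
    (∀ (T : Point → Point) → IsSimilarity T →
      ∀ a b → S a → S b → T a ≡ origin → T b ≡ e₁ →
      ∀ p → S p → HasForm k (T p)))
lemma4p1 ℝ S rms = + K , K-squareFree , normal-form
  where
  open RealField ℝ
  open Fractions ℝ
  open RationalMedianSets ℝ S rms
  open SquareRootClass ℝ
  open import Data.Integer using (+_)
  open import Data.Product using (proj₁; proj₂)
  open RationalOver√ (rationalOver√ (squareFreeRoot Δ≢0 (cross-fraction Sq₁ Sq₂ Sq₃)))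

  normal-form : ∀ T → IsSimilarity T → ∀ a b → S a → S b → T a ≡ origin → T b ≡ e₁ →
    ∀ p → S p → HasForm (+ K) (T p)
  normal-form T similarity a b Sa Sb Ta≡O Tb≡e₁ p Sp =
    r , √K , fraction⇒rational x-fraction , fraction⇒rational r-fraction , 0≤√K , √K²≡K , y≡r√K
    where
    coordinates = normalised-coordinates similarity Sa Sb Ta≡O Tb≡e₁ Sp
    x-fraction = proj₁ coordinates
    y-over-√K = over-√K (proj₂ (T p)) (proj₂ coordinates)
    r = proj₁ y-over-√K
    r-fraction = proj₁ (proj₂ y-over-√K)
    y≡r√K = proj₂ (proj₂ y-over-√K)
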